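{- Let $n$ be a positive integer, $D_n=\langle x,a\mid x^n=a^2=e,\ ax=x^{ -1}a\rangle$, $C_n=\langle x\rangle$. Let $v$ be an odd positive divisor of $n$ and $l=n/v$. Let $T\subseteq\{e,x^1,\dots,x^{v-1}\}$ with $e\in T$, let $Y=T\langle x^v\rangle=\bigcup_{x^b\in T}x^b\langle x^v\rangle$ and $X=Y\setminus\langle x^v\rangle$, and suppose that, in $\mathbb{Z}[C_n]$, $\overline{Y}+\overline{Y^{(-1)}}=\overline{C_n}+\overline{\langle x^v\rangle}$. Then the Cayley graph $\mathcal{C}(D_n,X\cup Ya)$ is a directed strongly regular graph with parameters $$\left(2n,\;n,\;\frac{n+l}{2},\;\frac{n-l}{2},\;\frac{n+l}{2}\right).$$
   Context: $Ya=\{ga:g\in Y\}$, $Y^{(-1)}=\{g^{ -1}:g\in Y\}$, and for $U\subseteq C_n$, $\overline{U}=\sum_{u\in U}u\in\mathbb{Z}[C_n]$. For $S\subseteq G\setminus\{e\}$, the Cayley graph $\mathcal{C}(G,S)$ has vertex set $G$ and an arc $u\to w$ iff $wu^{ -1}\in S$. A directed graph on $N$ vertices with $0/1$ adjacency matrix $A$ is a directed strongly regular graph with parameters $(N,k,\mu,\lambda,t)$ if $JA=AJ=kJ$ and $A^2=tI+\lambda A+\mu(J-I-A)$. -}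

module Defs where

open import Data.Nat as ℕ using (ℕ; zero; suc; NonZero; _≡ᵇ_)
open import Data.Nat.DivMod using (_mod_; _%_)
open import Data.Integer as ℤ using (ℤ; +_)
open import Data.Fin as Fin using (Fin; toℕ; splitAt)
open import Data.Fin.Properties using () renaming (_≟_ to _≟ᶠ_)
open import Data.Bool using (Bool; true; false; if_then_else_; _∧_; _∨_; not; _xor_)
open import Data.List using (List; allFin)
open import Data.Bool.ListAction using (any)
open import Data.Product using (_×_; _,_)
open import Data.Sum using (inj₁; inj₂)
open import Relation.Nullary.Decidable using (⌊_⌋)
open import Relation.Binary.PropositionalEquality using (_≡_)

∑ : (N : ℕ) → (Fin N → ℤ) → ℤ
∑ zero    f = + 0
∑ (suc N) f = f Fin.zero ℤ.+ ∑ N (λ i → f (Fin.suc i))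

χ : Bool → ℤ
χ b = if b then + 1 else + 0

χℕ : Bool → ℕ
χℕ b = if b then 1 else 0

record IsDSRG (N k μ λ' t : ℕ) (arc : Fin N → Fin N → Bool) : Set where
  A : Fin N → Fin N → ℤ
  A u w = χ (arc u w)
  I : Fin N → Fin N → ℤ
  I u w = χ ⌊ u ≟ᶠ w ⌋
  field
    rowSum : ∀ u → ∑ N (λ w → A u w) ≡ + k
    colSum : ∀ w → ∑ N (λ u → A u w) ≡ + k
    square : ∀ u w →
      ∑ N (λ z → A u z ℤ.* A z w)
        ≡ (+ t) ℤ.* I u w ℤ.+ (+ λ') ℤ.* A u w
            ℤ.+ (+ μ) ℤ.* ((+ 1 ℤ.- I u w) ℤ.- A u w)

-- The dihedral group D_n = ⟨x,a | xⁿ = a² = e, ax = x⁻¹a⟩.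
-- The element (i , s) stands for x^i a^s  (i ∈ Fin n, s = true means a).

Dih : ℕ → Set
Dih n = Fin n × Bool

module Dihedral (n : ℕ) .{{_ : NonZero n}} where

  _⊕_ : Fin n → Fin n → Fin n
  i ⊕ j = (toℕ i ℕ.+ toℕ j) mod n

  ⊖_ : Fin n → Fin n
  ⊖ i = (n ℕ.∸ toℕ i) mod n

  e : Dih n
  e = (0 mod n , false)

  -- (x^i a^s)(x^j a^t) = x^(i ± j) a^(s+t), using a x^j = x^(-j) a
  _·_ : Dih n → Dih n → Dih n
  (i , false) · (j , t) = (i ⊕ j , t)
  (i , true)  · (j , t) = (i ⊕ (⊖ j) , not t)

  inv : Dih n → Dih n
  inv (i , false) = (⊖ i , false)
  inv (i , true)  = (i , true)

  cayleyArc : (Dih n → Bool) → Dih n → Dih n → Bool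
  cayleyArc S u w = S (w · inv u)

  vertex : Fin (n ℕ.+ n) → Dih n
  vertex p with splitAt n p
  ... | inj₁ i = (i , false)
  ... | inj₂ i = (i , true)

  inH : ℕ → Fin n → Bool
  inH v c = any (λ k → ⌊ c ≟ᶠ ((toℕ k ℕ.* v) mod n) ⌋) (allFin n)

  inY : (v : ℕ) → (Fin v → Bool) → Fin n → Bool
  inY v T c = any (λ b → T b ∧ any (λ k → ⌊ c ≟ᶠ ((toℕ b ℕ.+ toℕ k ℕ.* v) mod n) ⌋) (allFin n)) (allFin v)

  inX : (v : ℕ) → (Fin v → Bool) → Fin n → Bool
  inX v T c = inY v T c ∧ not (inH v c)

  connSet : (v : ℕ) → (Fin v → Bool) → Dih n → Bool
  connSet v T (c , false) = inX v T c
  connSet v T (c , true)  = inY v T c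

  graphArc : (v : ℕ) → (Fin v → Bool) → Fin (n ℕ.+ n) → Fin (n ℕ.+ n) → Bool
  graphArc v T p q = cayleyArc (connSet v T) (vertex p) (vertex q)

-- Read subsets of Cₙ = ⟨x⟩ through exponents, as v-periodic 0/1 functions on ℤ: Y and H for Y and
-- ⟨xᵛ⟩, and X = Y − H for X.  The hypothesis becomes Y(x) + Y(−x) = 1 + H(x); hence X(x) = 1 − Y(−x),
-- and Y meets every period in (v + 1)/2 points.  Each entry of A and of A² is then a sum over the
-- n = l·v exponents of products of shifted copies of X, Y and H.  Such a sum is l times a sum over one
-- period, shifting or reflecting the argument does not change it, and H acts as a delta at 0.  After
-- substituting X = Y − H = 1 − Y(−·) the correlations of Y with itself cancel, leaving
-- A² = μ J − l A with μ = l(v + 1)/2 = (n + l)/2; this is the claimed identity with t = μ, λ = μ − l.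

module Submission where

module RangeSums where

  open import Data.Nat as ℕ using (ℕ; zero; suc; z≤n; s≤s)
  open import Data.Integer using (ℤ; +_; _+_; -_; _-_; 0ℤ; 1ℤ)
  open import Data.Integer.Properties using (+-identityˡ; +-assoc; +-comm)
  open import Data.Integer.Tactic.RingSolver using (solve-∀)
  open import Data.Fin using (Fin; zero; suc; toℕ; _↑ˡ_; _↑ʳ_)
  open import Function using (_∘_)
  open import Relation.Binary.PropositionalEquality
  open import Defs using (∑)

  ∑-cong : ∀ N {f g : Fin N → ℤ} → (∀ i → f i ≡ g i) → ∑ N f ≡ ∑ N g
  ∑-cong zero    _   = refl
  ∑-cong (suc N) f≗g = cong₂ _+_ (f≗g zero) (∑-cong N (f≗g ∘ suc))

  ∑-distrib-+ : ∀ N (f g : Fin N → ℤ) → ∑ N (λ i → f i + g i) ≡ ∑ N f + ∑ N g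
  ∑-distrib-+ zero    _ _ = refl
  ∑-distrib-+ (suc N) f g =
    trans (cong (λ s → f zero + g zero + s) (∑-distrib-+ N (f ∘ suc) (g ∘ suc)))
          (interchange (f zero) (g zero) (∑ N (f ∘ suc)) (∑ N (g ∘ suc)))
    where interchange : ∀ a b c d → a + b + (c + d) ≡ a + c + (b + d)
          interchange = solve-∀

  ∑-distrib-- : ∀ N (f g : Fin N → ℤ) → ∑ N (λ i → f i - g i) ≡ ∑ N f - ∑ N g
  ∑-distrib-- zero    _ _ = refl
  ∑-distrib-- (suc N) f g =
    trans (cong (λ s → f zero - g zero + s) (∑-distrib-- N (f ∘ suc) (g ∘ suc)))
          (interchange (f zero) (g zero) (∑ N (f ∘ suc)) (∑ N (g ∘ suc)))
    where interchange : ∀ a b c d → a - b + (c - d) ≡ a + c - (b + d)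
          interchange = solve-∀

  ∑-one : ∀ N → ∑ N (λ _ → 1ℤ) ≡ + N
  ∑-one zero    = refl
  ∑-one (suc N) = cong (λ s → 1ℤ + s) (∑-one N)

  ∑-splitAt : ∀ m k (f : Fin (m ℕ.+ k) → ℤ) →
              ∑ (m ℕ.+ k) f ≡ ∑ m (λ i → f (i ↑ˡ k)) + ∑ k (λ i → f (m ↑ʳ i))
  ∑-splitAt zero    k f = sym (+-identityˡ _)
  ∑-splitAt (suc m) k f =
    trans (cong (λ s → f zero + s) (∑-splitAt m k (f ∘ suc))) (sym (+-assoc (f zero) _ _))

  ∑ℤ : ℕ → (ℤ → ℤ) → ℤ
  ∑ℤ N φ = ∑ N (λ j → φ (+ toℕ j))

  ∑ℤ-cong : ∀ N {φ ψ : ℤ → ℤ} → (∀ x → φ x ≡ ψ x) → ∑ℤ N φ ≡ ∑ℤ N ψ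
  ∑ℤ-cong N φ≗ψ = ∑-cong N (φ≗ψ ∘ (+_) ∘ toℕ)

  ∑ℤ-distrib-+ : ∀ N φ ψ → ∑ℤ N (λ x → φ x + ψ x) ≡ ∑ℤ N φ + ∑ℤ N ψ
  ∑ℤ-distrib-+ N φ ψ = ∑-distrib-+ N (φ ∘ (+_) ∘ toℕ) (ψ ∘ (+_) ∘ toℕ)

  ∑ℤ-distrib-- : ∀ N φ ψ → ∑ℤ N (λ x → φ x - ψ x) ≡ ∑ℤ N φ - ∑ℤ N ψ
  ∑ℤ-distrib-- N φ ψ = ∑-distrib-- N (φ ∘ (+_) ∘ toℕ) (ψ ∘ (+_) ∘ toℕ)

  ∑ℤ-++ : ∀ m k φ → ∑ℤ (m ℕ.+ k) φ ≡ ∑ℤ m φ + ∑ℤ k (λ x → φ (+ m + x))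
  ∑ℤ-++ zero    k φ = trans (∑ℤ-cong k (cong φ ∘ sym ∘ +-identityˡ)) (sym (+-identityˡ _))
  ∑ℤ-++ (suc m) k φ = begin
    φ 0ℤ + ∑ℤ (m ℕ.+ k) (λ x → φ (1ℤ + x))
      ≡⟨ cong (λ s → φ 0ℤ + s) (∑ℤ-++ m k (λ x → φ (1ℤ + x))) ⟩
    φ 0ℤ + (∑ℤ m (λ x → φ (1ℤ + x)) + ∑ℤ k (λ x → φ (1ℤ + (+ m + x))))
      ≡⟨ cong (λ s → φ 0ℤ + (∑ℤ m (λ x → φ (1ℤ + x)) + s))
              (∑ℤ-cong k (cong φ ∘ sym ∘ +-assoc 1ℤ (+ m))) ⟩
    φ 0ℤ + (∑ℤ m (λ x → φ (1ℤ + x)) + ∑ℤ k (λ x → φ (+ suc m + x)))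
      ≡⟨ sym (+-assoc (φ 0ℤ) _ _) ⟩
    ∑ℤ (suc m) φ + ∑ℤ k (λ x → φ (+ suc m + x))
      ∎
    where open ≡-Reasoning

  ∑ℤ-init-last : ∀ m φ → ∑ℤ (suc m) φ ≡ ∑ℤ m φ + φ (+ m)
  ∑ℤ-init-last zero    φ = +-comm (φ 0ℤ) 0ℤ
  ∑ℤ-init-last (suc m) φ =
    trans (cong (λ s → φ 0ℤ + s) (∑ℤ-init-last m (λ x → φ (1ℤ + x)))) (sym (+-assoc (φ 0ℤ) _ _))

  ∑ℤ-vanishing : ∀ m φ → (∀ j → j ℕ.< m → φ (+ j) ≡ 0ℤ) → ∑ℤ m φ ≡ 0ℤ
  ∑ℤ-vanishing zero    _ _   = refl
  ∑ℤ-vanishing (suc m) φ φ≡0 =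
    cong₂ _+_ (φ≡0 0 (s≤s z≤n))
              (∑ℤ-vanishing m (λ x → φ (1ℤ + x)) (λ j j<m → φ≡0 (suc j) (s≤s j<m)))

  ∑ℤ-reverse : ∀ m φ → ∑ℤ m (λ x → φ (- x)) ≡ ∑ℤ m (λ x → φ (x + (1ℤ - + m)))
  ∑ℤ-reverse zero    _ = refl
  ∑ℤ-reverse (suc m) φ = begin
    φ 0ℤ + ∑ℤ m (λ x → φ (- (1ℤ + x)))
      ≡⟨ cong (λ s → φ 0ℤ + s) (∑ℤ-cong m (cong φ ∘ neg-suc)) ⟩
    φ 0ℤ + ∑ℤ m (λ x → φ (- x - 1ℤ))
      ≡⟨ cong (λ s → φ 0ℤ + s) (∑ℤ-reverse m (λ y → φ (y - 1ℤ))) ⟩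
    φ 0ℤ + ∑ℤ m (λ x → φ (x + (1ℤ - + m) - 1ℤ))
      ≡⟨ +-comm (φ 0ℤ) _ ⟩
    ∑ℤ m (λ x → φ (x + (1ℤ - + m) - 1ℤ)) + φ 0ℤ
      ≡⟨ cong₂ _+_ (∑ℤ-cong m (cong φ ∘ shift-pred (+ m))) (cong φ (last-zero (+ m))) ⟩
    ∑ℤ m (λ x → φ (x + (1ℤ - (1ℤ + + m)))) + φ (+ m + (1ℤ - (1ℤ + + m)))
      ≡⟨ sym (∑ℤ-init-last m (λ x → φ (x + (1ℤ - + suc m)))) ⟩
    ∑ℤ (suc m) (λ x → φ (x + (1ℤ - + suc m)))
      ∎
    where
      open ≡-Reasoning
      neg-suc : ∀ x → - (1ℤ + x) ≡ - x - 1ℤ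
      neg-suc = solve-∀
      shift-pred : ∀ m x → x + (1ℤ - m) - 1ℤ ≡ x + (1ℤ - (1ℤ + m))
      shift-pred = solve-∀
      last-zero : ∀ m → 0ℤ ≡ m + (1ℤ - (1ℤ + m))
      last-zero = solve-∀

module PeriodicSums where

  open import Data.Nat as ℕ using (ℕ; zero; suc)
  open import Data.Integer using (ℤ; +_; -[1+_]; _+_; _*_; -_; _-_; 0ℤ; 1ℤ)
  open import Data.Integer.Properties using (+-identityˡ; +-identityʳ; +-comm; *-identityˡ)
  open import Data.Integer.Tactic.RingSolver using (solve-∀)
  open import Function using (_∘_)
  open import Relation.Binary.PropositionalEquality
  open RangeSums

  Periodic : ℕ → (ℤ → ℤ) → Set
  Periodic v φ = ∀ x → φ (x + + v) ≡ φ x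

  periodic-shift : ∀ {v φ} c → Periodic v φ → Periodic v (λ x → φ (x + c))
  periodic-shift {v} {φ} c φ-periodic x = trans (cong φ (swap x c (+ v))) (φ-periodic (x + c))
    where swap : ∀ x c v → x + v + c ≡ x + c + v
          swap = solve-∀

  periodic-* : ∀ {v φ ψ} → Periodic v φ → Periodic v ψ → Periodic v (λ x → φ x * ψ x)
  periodic-* φ-periodic ψ-periodic x = cong₂ _*_ (φ-periodic x) (ψ-periodic x)

  ∑ℤ-period-shift-suc : ∀ v {φ} → Periodic v φ →
                        ∀ c → ∑ℤ v (λ x → φ (x + (1ℤ + c))) ≡ ∑ℤ v (λ x → φ (x + c))
  ∑ℤ-period-shift-suc zero    _ _ = refl
  ∑ℤ-period-shift-suc (suc v) {φ} φ-periodic c = begin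
    ∑ℤ (suc v) (λ x → φ (x + (1ℤ + c)))
      ≡⟨ ∑ℤ-init-last v (λ x → φ (x + (1ℤ + c))) ⟩
    ∑ℤ v (λ x → φ (x + (1ℤ + c))) + φ (+ v + (1ℤ + c))
      ≡⟨ cong₂ _+_ (∑ℤ-cong v (cong φ ∘ reassoc c)) (trans (cong φ (wrap (+ v) c)) (φ-periodic c)) ⟩
    ∑ℤ v (λ x → φ (1ℤ + x + c)) + φ c
      ≡⟨ +-comm _ (φ c) ⟩
    φ c + ∑ℤ v (λ x → φ (1ℤ + x + c))
      ≡⟨ cong (λ y → φ y + ∑ℤ v (λ x → φ (1ℤ + x + c))) (sym (+-identityˡ c)) ⟩
    ∑ℤ (suc v) (λ x → φ (x + c))
      ∎
    where
      open ≡-Reasoning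
      reassoc : ∀ c x → x + (1ℤ + c) ≡ 1ℤ + x + c
      reassoc = solve-∀
      wrap : ∀ w c → w + (1ℤ + c) ≡ c + (1ℤ + w)
      wrap = solve-∀

  ∑ℤ-period-shift : ∀ {v φ} → Periodic v φ → ∀ c → ∑ℤ v (λ x → φ (x + c)) ≡ ∑ℤ v φ
  ∑ℤ-period-shift {v} {φ} φ-periodic c = trans (from-origin c) (∑ℤ-cong v (cong φ ∘ +-identityʳ))
    where
      shifted : ℤ → ℤ
      shifted c = ∑ℤ v (λ x → φ (x + c))
      suc-neg : ∀ k → 1ℤ + -[1+ k ] ≡ - + k
      suc-neg zero    = refl
      suc-neg (suc k) = refl
      from-origin-neg : ∀ k → shifted (- + k) ≡ shifted 0ℤ
      from-origin-neg zero    = refl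
      from-origin-neg (suc k) = trans (sym (∑ℤ-period-shift-suc v φ-periodic -[1+ k ]))
                                      (trans (cong shifted (suc-neg k)) (from-origin-neg k))
      from-origin : ∀ c → shifted c ≡ shifted 0ℤ
      from-origin (+ zero)  = refl
      from-origin (+ suc k) = trans (∑ℤ-period-shift-suc v φ-periodic (+ k)) (from-origin (+ k))
      from-origin -[1+ k ]  = from-origin-neg (suc k)

  ∑ℤ-period-reflect : ∀ {v φ} → Periodic v φ → ∑ℤ v (λ x → φ (- x)) ≡ ∑ℤ v φ
  ∑ℤ-period-reflect {v} {φ} φ-periodic =
    trans (∑ℤ-reverse v φ) (∑ℤ-period-shift φ-periodic (1ℤ - + v))

  ∑ℤ-periods : ∀ {v φ} → Periodic v φ → ∀ l → ∑ℤ (l ℕ.* v) φ ≡ + l * ∑ℤ v φ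
  ∑ℤ-periods         _          zero    = refl
  ∑ℤ-periods {v} {φ} φ-periodic (suc l) = begin
    ∑ℤ (v ℕ.+ l ℕ.* v) φ
      ≡⟨ ∑ℤ-++ v (l ℕ.* v) φ ⟩
    ∑ℤ v φ + ∑ℤ (l ℕ.* v) (λ x → φ (+ v + x))
      ≡⟨ cong (λ s → ∑ℤ v φ + s)
              (∑ℤ-cong (l ℕ.* v) (λ x → trans (cong φ (+-comm (+ v) x)) (φ-periodic x))) ⟩
    ∑ℤ v φ + ∑ℤ (l ℕ.* v) φ
      ≡⟨ cong (λ s → ∑ℤ v φ + s) (∑ℤ-periods φ-periodic l) ⟩
    ∑ℤ v φ + + l * ∑ℤ v φ
      ≡⟨ collect (∑ℤ v φ) (+ l) ⟩
    (1ℤ + + l) * ∑ℤ v φ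
      ∎
    where
      open ≡-Reasoning
      collect : ∀ s l → s + l * s ≡ (1ℤ + l) * s
      collect = solve-∀

  ∑ℤ-periods-shift : ∀ {v φ} → Periodic v φ → ∀ l c →
                     ∑ℤ (l ℕ.* v) (λ x → φ (x + c)) ≡ ∑ℤ (l ℕ.* v) φ
  ∑ℤ-periods-shift {v} {φ} φ-periodic l c = begin
    ∑ℤ (l ℕ.* v) (λ x → φ (x + c))  ≡⟨ ∑ℤ-periods (periodic-shift c φ-periodic) l ⟩
    + l * ∑ℤ v (λ x → φ (x + c))    ≡⟨ cong (λ s → + l * s) (∑ℤ-period-shift φ-periodic c) ⟩
    + l * ∑ℤ v φ                    ≡⟨ sym (∑ℤ-periods φ-periodic l) ⟩
    ∑ℤ (l ℕ.* v) φ                  ∎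
    where open ≡-Reasoning

  ∑ℤ-delta : ∀ v {H F : ℤ → ℤ} → H 0ℤ ≡ 1ℤ → (∀ j → j ℕ.< v → H (+ suc j) ≡ 0ℤ) →
             ∑ℤ (suc v) (λ x → H x * F x) ≡ F 0ℤ
  ∑ℤ-delta v {H} {F} H0≡1 H≡0 = begin
    H 0ℤ * F 0ℤ + ∑ℤ v (λ x → H (1ℤ + x) * F (1ℤ + x))
      ≡⟨ cong₂ _+_ (cong (λ h → h * F 0ℤ) H0≡1)
                   (∑ℤ-vanishing v (λ x → H (1ℤ + x) * F (1ℤ + x))
                                   (λ j j<v → cong (λ h → h * F (+ suc j)) (H≡0 j j<v))) ⟩
    1ℤ * F 0ℤ + 0ℤ
      ≡⟨ trans (+-identityʳ _) (*-identityˡ _) ⟩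
    F 0ℤ
      ∎
    where open ≡-Reasoning

  ∑ℤ-periods-delta : ∀ v {H F : ℤ → ℤ} → Periodic (suc v) H → Periodic (suc v) F →
                     H 0ℤ ≡ 1ℤ → (∀ j → j ℕ.< v → H (+ suc j) ≡ 0ℤ) →
                     ∀ l a b → ∑ℤ (l ℕ.* suc v) (λ x → H (x + a) * F (x + b)) ≡ + l * F (b - a)
  ∑ℤ-periods-delta v {H} {F} H-periodic F-periodic H0≡1 H≡0 l a b = begin
    ∑ℤ N (λ x → H (x + a) * F (x + b))
      ≡⟨ sym (∑ℤ-periods-shift (periodic-* (periodic-shift a H-periodic) (periodic-shift b F-periodic))
                               l (- a)) ⟩
    ∑ℤ N (λ x → H (x - a + a) * F (x - a + b))
      ≡⟨ ∑ℤ-cong N (λ x → cong₂ _*_ (cong H (cancel x a)) (cong F (reassoc x a b))) ⟩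
    ∑ℤ N (λ x → H x * F (x + (b - a)))
      ≡⟨ ∑ℤ-periods (periodic-* H-periodic (periodic-shift (b - a) F-periodic)) l ⟩
    + l * ∑ℤ (suc v) (λ x → H x * F (x + (b - a)))
      ≡⟨ cong (λ s → + l * s) (trans (∑ℤ-delta v {H} {λ x → F (x + (b - a))} H0≡1 H≡0)
                                     (cong F (+-identityˡ (b - a)))) ⟩
    + l * F (b - a)
      ∎
    where
      open ≡-Reasoning
      N : ℕ
      N = l ℕ.* suc v
      cancel : ∀ x a → x - a + a ≡ x
      cancel = solve-∀
      reassoc : ∀ x a b → x - a + b ≡ x + (b - a)
      reassoc = solve-∀

module CountingIdentities where

  open import Data.Nat as ℕ using (ℕ; suc)
  open import Data.Integer using (ℤ; +_; _+_; _*_; -_; _-_; 0ℤ; 1ℤ)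
  open import Data.Integer.Properties using (+-comm; *-comm; *-identityʳ; *-cancelˡ-≡; pos-+; pos-*)
  open import Data.Integer.Tactic.RingSolver using (solve-∀)
  open import Relation.Binary.PropositionalEquality
  open RangeSums
  open PeriodicSums

  module Indicators
      (a l : ℕ) (Y H : ℤ → ℤ)
      (Y-periodic : Periodic (suc (a ℕ.+ a)) Y) (H-periodic : Periodic (suc (a ℕ.+ a)) H)
      (H-origin : H 0ℤ ≡ 1ℤ) (H-vanishes : ∀ j → j ℕ.< a ℕ.+ a → H (+ suc j) ≡ 0ℤ)
      (Y-pairing : ∀ x → Y x + Y (- x) ≡ 1ℤ + H x)
      where

    v N : ℕ
    v = suc (a ℕ.+ a)
    N = l ℕ.* v

    μ : ℤ
    μ = + l * (1ℤ + + a)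

    X : ℤ → ℤ
    X x = Y x - H x

    X-reflect : ∀ x → X x ≡ 1ℤ - Y (- x)
    X-reflect x = begin
      Y x - H x                        ≡⟨ regroup (Y x) (Y (- x)) (H x) ⟩
      (Y x + Y (- x)) - H x - Y (- x)  ≡⟨ cong (λ s → s - H x - Y (- x)) (Y-pairing x) ⟩
      1ℤ + H x - H x - Y (- x)         ≡⟨ cancel (H x) (Y (- x)) ⟩
      1ℤ - Y (- x)                     ∎
      where
        open ≡-Reasoning
        regroup : ∀ y y′ h → y - h ≡ (y + y′) - h - y′
        regroup = solve-∀
        cancel : ∀ h y′ → 1ℤ + h - h - y′ ≡ 1ℤ - y′
        cancel = solve-∀

    X-reflect-diff : ∀ Q J → X (Q - J) ≡ 1ℤ - Y (J - Q)
    X-reflect-diff Q J = trans (X-reflect (Q - J)) (cong (λ y → 1ℤ - Y y) (flip Q J))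
      where flip : ∀ Q J → - (Q - J) ≡ J - Q
            flip = solve-∀

    ∑H-period : ∑ℤ v H ≡ 1ℤ
    ∑H-period = trans (∑ℤ-cong v (λ x → sym (*-identityʳ (H x))))
                      (∑ℤ-delta (a ℕ.+ a) {H} {λ _ → 1ℤ} H-origin H-vanishes)

    ∑Y-period : ∑ℤ v Y ≡ 1ℤ + + a
    ∑Y-period = *-cancelˡ-≡ (+ 2) (∑ℤ v Y) (1ℤ + + a) (begin
      + 2 * ∑ℤ v Y
        ≡⟨ double (∑ℤ v Y) ⟩
      ∑ℤ v Y + ∑ℤ v Y
        ≡⟨ cong (λ s → ∑ℤ v Y + s) (sym (∑ℤ-period-reflect Y-periodic)) ⟩
      ∑ℤ v Y + ∑ℤ v (λ x → Y (- x))
        ≡⟨ sym (∑ℤ-distrib-+ v Y (λ x → Y (- x))) ⟩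
      ∑ℤ v (λ x → Y x + Y (- x))
        ≡⟨ ∑ℤ-cong v Y-pairing ⟩
      ∑ℤ v (λ x → 1ℤ + H x)
        ≡⟨ ∑ℤ-distrib-+ v (λ _ → 1ℤ) H ⟩
      ∑ℤ v (λ _ → 1ℤ) + ∑ℤ v H
        ≡⟨ cong₂ _+_ (∑-one v) ∑H-period ⟩
      1ℤ + + (a ℕ.+ a) + 1ℤ
        ≡⟨ cong (λ s → 1ℤ + s + 1ℤ) (pos-+ a a) ⟩
      1ℤ + (+ a + + a) + 1ℤ
        ≡⟨ halve (+ a) ⟩
      + 2 * (1ℤ + + a)
        ∎)
      where
        open ≡-Reasoning
        double : ∀ s → (1ℤ + 1ℤ) * s ≡ s + s
        double = solve-∀
        halve : ∀ a → 1ℤ + (a + a) + 1ℤ ≡ (1ℤ + 1ℤ) * (1ℤ + a)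
        halve = solve-∀

    ∑Y-shifted : ∀ c → ∑ℤ N (λ x → Y (x + c)) ≡ μ
    ∑Y-shifted c = begin
      ∑ℤ N (λ x → Y (x + c))  ≡⟨ ∑ℤ-periods-shift Y-periodic l c ⟩
      ∑ℤ N Y                  ≡⟨ ∑ℤ-periods Y-periodic l ⟩
      + l * ∑ℤ v Y            ≡⟨ cong (λ s → + l * s) ∑Y-period ⟩
      μ                       ∎
      where open ≡-Reasoning

    ∑H-shifted : ∀ c → ∑ℤ N (λ x → H (x + c)) ≡ + l
    ∑H-shifted c = begin
      ∑ℤ N (λ x → H (x + c))  ≡⟨ ∑ℤ-periods-shift H-periodic l c ⟩
      ∑ℤ N H                  ≡⟨ ∑ℤ-periods H-periodic l ⟩
      + l * ∑ℤ v H            ≡⟨ cong (λ s → + l * s) ∑H-period ⟩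
      + l * 1ℤ                ≡⟨ *-identityʳ (+ l) ⟩
      + l                     ∎
      where open ≡-Reasoning

    ∑X-shifted : ∀ c → ∑ℤ N (λ x → X (x + c)) ≡ μ - + l
    ∑X-shifted c = trans (∑ℤ-distrib-- N (λ x → Y (x + c)) (λ x → H (x + c)))
                         (cong₂ _-_ (∑Y-shifted c) (∑H-shifted c))

    N≡2μ-l : + N ≡ μ + μ - + l
    N≡2μ-l = begin
      + (l ℕ.* suc (a ℕ.+ a))       ≡⟨ pos-* l (suc (a ℕ.+ a)) ⟩
      + l * (1ℤ + + (a ℕ.+ a))      ≡⟨ cong (λ s → + l * (1ℤ + s)) (pos-+ a a) ⟩
      + l * (1ℤ + (+ a + + a))      ≡⟨ expand (+ l) (+ a) ⟩
      μ + μ - + l                   ∎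
      where
        open ≡-Reasoning
        expand : ∀ l a → l * (1ℤ + (a + a)) ≡ l * (1ℤ + a) + l * (1ℤ + a) - l
        expand = solve-∀

    row-identity : ∀ P → ∑ℤ N (λ J → X (J - P)) + ∑ℤ N (λ J → Y (J + P)) ≡ + N
    row-identity P = begin
      ∑ℤ N (λ J → X (J - P)) + ∑ℤ N (λ J → Y (J + P))
        ≡⟨ cong₂ _+_ (∑X-shifted (- P)) (∑Y-shifted P) ⟩
      μ - + l + μ
        ≡⟨ swap μ (+ l) ⟩
      μ + μ - + l
        ≡⟨ sym N≡2μ-l ⟩
      + N
        ∎
      where
        open ≡-Reasoning
        swap : ∀ m l → m - l + m ≡ m + m - l
        swap = solve-∀

    column-identity : ∀ Q → ∑ℤ N (λ J → X (Q - J)) + ∑ℤ N (λ J → Y (Q + J)) ≡ + N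
    column-identity Q = begin
      ∑ℤ N (λ J → X (Q - J)) + ∑ℤ N (λ J → Y (Q + J))
        ≡⟨ cong₂ _+_ (∑ℤ-cong N (X-reflect-diff Q)) (∑ℤ-cong N (λ J → cong Y (+-comm Q J))) ⟩
      ∑ℤ N (λ J → 1ℤ - Y (J - Q)) + ∑ℤ N (λ J → Y (J + Q))
        ≡⟨ cong₂ _+_ (∑ℤ-distrib-- N (λ _ → 1ℤ) (λ J → Y (J - Q))) (∑Y-shifted Q) ⟩
      ∑ℤ N (λ _ → 1ℤ) - ∑ℤ N (λ J → Y (J - Q)) + μ
        ≡⟨ cong₂ (λ s t → s - t + μ) (∑-one N) (∑Y-shifted (- Q)) ⟩
      + N - μ + μ
        ≡⟨ cancel (+ N) μ ⟩
      + N
        ∎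
      where
        open ≡-Reasoning
        cancel : ∀ n m → n - m + m ≡ n
        cancel = solve-∀

    square-identity-X : ∀ P Q → ∑ℤ N (λ J → X (J - P) * X (Q - J)) + ∑ℤ N (λ J → Y (J + P) * Y (Q + J))
                                  ≡ μ - + l * X (Q - P)
    square-identity-X P Q = begin
      ∑ℤ N (λ J → X (J - P) * X (Q - J)) + ∑ℤ N (λ J → Y (J + P) * Y (Q + J))
        ≡⟨ cong₂ _+_ (∑ℤ-cong N expand) (∑ℤ-cong N shift) ⟩
      ∑ℤ N (λ J → X (J - P) - φ J + H (J - P) * Y (J - Q)) + ∑ℤ N (λ J → φ (J + (P + Q)))
        ≡⟨ cong₂ _+_ (trans (∑ℤ-distrib-+ N (λ J → X (J - P) - φ J) (λ J → H (J - P) * Y (J - Q)))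
                            (cong (λ s → s + ∑ℤ N (λ J → H (J - P) * Y (J - Q)))
                                  (∑ℤ-distrib-- N (λ J → X (J - P)) φ)))
                     (∑ℤ-periods-shift φ-periodic l (P + Q)) ⟩
      ∑ℤ N (λ J → X (J - P)) - ∑ℤ N φ + ∑ℤ N (λ J → H (J - P) * Y (J - Q)) + ∑ℤ N φ
        ≡⟨ cong₂ (λ s t → s - ∑ℤ N φ + t + ∑ℤ N φ) (∑X-shifted (- P))
                 (∑ℤ-periods-delta (a ℕ.+ a) H-periodic Y-periodic H-origin H-vanishes l (- P) (- Q)) ⟩
      μ - + l - ∑ℤ N φ + + l * Y (- Q - - P) + ∑ℤ N φ
        ≡⟨ cong (λ y → μ - + l - ∑ℤ N φ + + l * Y y + ∑ℤ N φ) (flip P Q) ⟩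
      μ - + l - ∑ℤ N φ + + l * Y (P - Q) + ∑ℤ N φ
        ≡⟨ collect μ (+ l) (∑ℤ N φ) (Y (P - Q)) ⟩
      μ - + l * (1ℤ - Y (P - Q))
        ≡⟨ cong (λ s → μ - + l * s) (sym (X-reflect-diff Q P)) ⟩
      μ - + l * X (Q - P)
        ∎
      where
        open ≡-Reasoning
        φ : ℤ → ℤ
        φ x = Y (x - P) * Y (x - Q)
        φ-periodic : Periodic v φ
        φ-periodic = periodic-* (periodic-shift (- P) Y-periodic) (periodic-shift (- Q) Y-periodic)
        distribute : ∀ y h y′ → (y - h) * (1ℤ - y′) ≡ y - h - y * y′ + h * y′
        distribute = solve-∀
        expand : ∀ J → X (J - P) * X (Q - J) ≡ X (J - P) - φ J + H (J - P) * Y (J - Q)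
        expand J = trans (cong (λ y → X (J - P) * y) (X-reflect-diff Q J))
                         (distribute (Y (J - P)) (H (J - P)) (Y (J - Q)))
        reassoc : ∀ J P Q → J + (P + Q) - P ≡ Q + J
        reassoc = solve-∀
        reassoc′ : ∀ J P Q → J + (P + Q) - Q ≡ J + P
        reassoc′ = solve-∀
        shift : ∀ J → Y (J + P) * Y (Q + J) ≡ φ (J + (P + Q))
        shift J = trans (*-comm (Y (J + P)) (Y (Q + J)))
                        (sym (cong₂ _*_ (cong Y (reassoc J P Q)) (cong Y (reassoc′ J P Q))))
        flip : ∀ P Q → - Q - - P ≡ P - Q
        flip = solve-∀
        collect : ∀ m l s y → m - l - s + l * y + s ≡ m - l * (1ℤ - y)
        collect = solve-∀

    square-identity-Y : ∀ P Q → ∑ℤ N (λ J → X (J - P) * Y (Q + J)) + ∑ℤ N (λ J → Y (J + P) * X (Q - J))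
                                  ≡ μ - + l * Y (Q + P)
    square-identity-Y P Q = begin
      ∑ℤ N (λ J → X (J - P) * Y (Q + J)) + ∑ℤ N (λ J → Y (J + P) * X (Q - J))
        ≡⟨ cong₂ _+_ (∑ℤ-cong N expandˡ) (∑ℤ-cong N expandʳ) ⟩
      ∑ℤ N (λ J → ψ (J - P) - H (J - P) * Y (J + Q)) + ∑ℤ N (λ J → Y (J + P) - ψ (J - Q))
        ≡⟨ cong₂ _+_ (∑ℤ-distrib-- N (λ J → ψ (J - P)) (λ J → H (J - P) * Y (J + Q)))
                     (∑ℤ-distrib-- N (λ J → Y (J + P)) (λ J → ψ (J - Q))) ⟩
      ∑ℤ N (λ J → ψ (J - P)) - ∑ℤ N (λ J → H (J - P) * Y (J + Q))
        + (∑ℤ N (λ J → Y (J + P)) - ∑ℤ N (λ J → ψ (J - Q)))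
        ≡⟨ cong₂ _+_ (cong₂ _-_ (∑ℤ-periods-shift ψ-periodic l (- P))
                                (∑ℤ-periods-delta (a ℕ.+ a) H-periodic Y-periodic H-origin H-vanishes l (- P) Q))
                     (cong₂ _-_ (∑Y-shifted P) (∑ℤ-periods-shift ψ-periodic l (- Q))) ⟩
      ∑ℤ N ψ - + l * Y (Q - - P) + (μ - ∑ℤ N ψ)
        ≡⟨ cong (λ y → ∑ℤ N ψ - + l * Y y + (μ - ∑ℤ N ψ)) (minus-neg Q P) ⟩
      ∑ℤ N ψ - + l * Y (Q + P) + (μ - ∑ℤ N ψ)
        ≡⟨ cancel (∑ℤ N ψ) (+ l * Y (Q + P)) μ ⟩
      μ - + l * Y (Q + P)
        ∎
      where
        open ≡-Reasoning
        ψ : ℤ → ℤ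
        ψ x = Y x * Y (x + (P + Q))
        ψ-periodic : Periodic v ψ
        ψ-periodic = periodic-* Y-periodic (periodic-shift (P + Q) Y-periodic)
        reassocˡ : ∀ J P Q → J + Q ≡ J - P + (P + Q)
        reassocˡ = solve-∀
        reassocʳ : ∀ J P Q → J + P ≡ J - Q + (P + Q)
        reassocʳ = solve-∀
        distribˡ : ∀ y h z → (y - h) * z ≡ y * z - h * z
        distribˡ = solve-∀
        distribʳ : ∀ y y′ → y * (1ℤ - y′) ≡ y - y′ * y
        distribʳ = solve-∀
        expandˡ : ∀ J → X (J - P) * Y (Q + J) ≡ ψ (J - P) - H (J - P) * Y (J + Q)
        expandˡ J = begin
          (Y (J - P) - H (J - P)) * Y (Q + J)         ≡⟨ cong (λ s → X (J - P) * Y s) (+-comm Q J) ⟩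
          (Y (J - P) - H (J - P)) * Y (J + Q)         ≡⟨ distribˡ (Y (J - P)) (H (J - P)) (Y (J + Q)) ⟩
          Y (J - P) * Y (J + Q) - H (J - P) * Y (J + Q)
            ≡⟨ cong (λ s → Y (J - P) * Y s - H (J - P) * Y (J + Q)) (reassocˡ J P Q) ⟩
          ψ (J - P) - H (J - P) * Y (J + Q)           ∎
        expandʳ : ∀ J → Y (J + P) * X (Q - J) ≡ Y (J + P) - ψ (J - Q)
        expandʳ J = begin
          Y (J + P) * X (Q - J)             ≡⟨ cong (λ s → Y (J + P) * s) (X-reflect-diff Q J) ⟩
          Y (J + P) * (1ℤ - Y (J - Q))      ≡⟨ distribʳ (Y (J + P)) (Y (J - Q)) ⟩
          Y (J + P) - Y (J - Q) * Y (J + P) ≡⟨ cong (λ s → Y (J + P) - Y (J - Q) * Y s) (reassocʳ J P Q) ⟩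
          Y (J + P) - ψ (J - Q)             ∎
        minus-neg : ∀ Q P → Q - - P ≡ Q + P
        minus-neg = solve-∀
        cancel : ∀ s t m → s - t + (m - s) ≡ m - t
        cancel = solve-∀

module Congruences where

  open import Data.Nat as ℕ using (ℕ; suc; NonZero)
  open import Data.Nat.DivMod using (_%_; m<n⇒m%n≡m; [m+kn]%n≡m%n)
  open import Data.Nat.Divisibility using (_∣_; divides; ∣-refl)
  open import Data.Integer using (ℤ; +_; -[1+_]; _+_; _*_; -_; 0ℤ; 1ℤ; _%ℕ_; _/ℕ_)
  open import Data.Integer.DivMod using (n%ℕd<d; a≡a%ℕn+[a/ℕn]*n)
  open import Data.Integer.Properties using (+-identityʳ; *-identityˡ; +-injective; pos-+; pos-*)
  open import Data.Integer.Tactic.RingSolver using (solve-∀)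
  open import Data.Fin using (Fin; fromℕ<)
  open import Data.Fin.Properties using (fromℕ<-cong)
  open import Relation.Binary.PropositionalEquality

  module Modulo (v : ℕ) .{{_ : NonZero v}} where

    infix 4 _≡ᵥ_
    record _≡ᵥ_ (x y : ℤ) : Set where
      constructor by
      field
        quotient : ℤ
        equation : x ≡ y + quotient * + v

    ≡⇒≡ᵥ : ∀ {x y} → x ≡ y → x ≡ᵥ y
    ≡⇒≡ᵥ {y = y} refl = by 0ℤ (sym (+-identityʳ y))

    ≡ᵥ-refl : ∀ {x} → x ≡ᵥ x
    ≡ᵥ-refl = ≡⇒≡ᵥ refl

    ≡ᵥ-sym : ∀ {x y} → x ≡ᵥ y → y ≡ᵥ x
    ≡ᵥ-sym {y = y} (by k x≡y+kv) =
      by (- k) (trans (cancel y k (+ v)) (cong (λ s → s + - k * + v) (sym x≡y+kv)))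
      where cancel : ∀ y k v → y ≡ y + k * v + - k * v
            cancel = solve-∀

    ≡ᵥ-trans : ∀ {x y z} → x ≡ᵥ y → y ≡ᵥ z → x ≡ᵥ z
    ≡ᵥ-trans {z = z} (by k x≡y+kv) (by k′ y≡z+k′v) =
      by (k′ + k) (trans x≡y+kv (trans (cong (λ s → s + k * + v) y≡z+k′v) (regroup z k k′ (+ v))))
      where regroup : ∀ z k k′ v → z + k′ * v + k * v ≡ z + (k′ + k) * v
            regroup = solve-∀

    +-cong-≡ᵥ : ∀ {x x′ y y′} → x ≡ᵥ x′ → y ≡ᵥ y′ → x + y ≡ᵥ x′ + y′
    +-cong-≡ᵥ {x′ = x′} {y′ = y′} (by k x≡) (by k′ y≡) =
      by (k + k′) (trans (cong₂ _+_ x≡ y≡) (regroup x′ y′ k k′ (+ v)))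
      where regroup : ∀ x y k k′ v → x + k * v + (y + k′ * v) ≡ x + y + (k + k′) * v
            regroup = solve-∀

    neg-cong-≡ᵥ : ∀ {x y} → x ≡ᵥ y → - x ≡ᵥ - y
    neg-cong-≡ᵥ {y = y} (by k x≡) = by (- k) (trans (cong -_ x≡) (negate y k (+ v)))
      where negate : ∀ y k v → - (y + k * v) ≡ - y + - k * v
            negate = solve-∀

    +v-≡ᵥ : ∀ x → x + + v ≡ᵥ x
    +v-≡ᵥ x = by 1ℤ (cong (λ s → x + s) (sym (*-identityˡ (+ v))))

    remainder-≡ᵥ : ∀ d .{{_ : NonZero d}} → v ∣ d → ∀ x → + (x %ℕ d) ≡ᵥ x
    remainder-≡ᵥ d (divides l d≡lv) x = by (- (x /ℕ d * + l)) (begin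
      + (x %ℕ d)                                       ≡⟨ isolate (+ (x %ℕ d)) (x /ℕ d) (+ l) (+ v) ⟩
      + (x %ℕ d) + x /ℕ d * (+ l * + v) + - (x /ℕ d * + l) * + v
        ≡⟨ cong (λ s → + (x %ℕ d) + x /ℕ d * s + - (x /ℕ d * + l) * + v)
                (sym (trans (cong +_ d≡lv) (pos-* l v))) ⟩
      + (x %ℕ d) + x /ℕ d * + d + - (x /ℕ d * + l) * + v
        ≡⟨ cong (λ s → s + - (x /ℕ d * + l) * + v) (sym (a≡a%ℕn+[a/ℕn]*n x d)) ⟩
      x + - (x /ℕ d * + l) * + v                       ∎)
      where
        open ≡-Reasoning
        isolate : ∀ r q l v → r ≡ r + q * (l * v) + - (q * l) * v
        isolate = solve-∀

    %-cong-multiple : ∀ {m m′} k → + m ≡ + m′ + + k * + v → m % v ≡ m′ % v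
    %-cong-multiple {m} {m′} k eq =
      trans (cong (_% v) (+-injective (trans eq (sym pos-sum)))) ([m+kn]%n≡m%n m′ k v)
      where pos-sum : + (m′ ℕ.+ k ℕ.* v) ≡ + m′ + + k * + v
            pos-sum = trans (pos-+ m′ (k ℕ.* v)) (cong (λ s → + m′ + s) (pos-* k v))

    %-cong : ∀ {m m′} → + m ≡ᵥ + m′ → m % v ≡ m′ % v
    %-cong   (by (+ k)    eq) = %-cong-multiple k eq
    %-cong p@(by -[1+ k ] _)  = sym (%-cong-multiple (suc k) (_≡ᵥ_.equation (≡ᵥ-sym p)))

    %ℕ-cong : ∀ {x y} → x ≡ᵥ y → x %ℕ v ≡ y %ℕ v
    %ℕ-cong {x} {y} x≡ᵥy = begin
      x %ℕ v          ≡⟨ sym (m<n⇒m%n≡m (n%ℕd<d x v)) ⟩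
      x %ℕ v % v      ≡⟨ %-cong (≡ᵥ-trans (remainder-≡ᵥ v ∣-refl x)
                                (≡ᵥ-trans x≡ᵥy (≡ᵥ-sym (remainder-≡ᵥ v ∣-refl y)))) ⟩
      y %ℕ v % v      ≡⟨ m<n⇒m%n≡m (n%ℕd<d y v) ⟩
      y %ℕ v          ∎
      where open ≡-Reasoning

    residue : ℤ → Fin v
    residue x = fromℕ< (n%ℕd<d x v)

    residue-cong : ∀ {x y} → x ≡ᵥ y → residue x ≡ residue y
    residue-cong {x} {y} x≡ᵥy = fromℕ<-cong _ _ (%ℕ-cong x≡ᵥy) (n%ℕd<d x v) (n%ℕd<d y v)

module DihedralFacts where

  open import Defs
  open import Data.Nat as ℕ using (ℕ; NonZero; _≡ᵇ_; _∸_)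
  open import Data.Nat.Properties using (≡ᵇ⇒≡; ≡⇒≡ᵇ; <⇒≤; ≤-<-trans)
  open import Data.Nat.DivMod
    using (_%_; _/_; _mod_; m<n⇒m%n≡m; m∣n⇒o%n%m≡o%m; [m+kn]%n≡m%n; m≡m%n+[m/n]*n; m/n≤m)
  open import Data.Nat.Divisibility using (divides)
  open import Data.Integer using (ℤ; +_; _+_; _*_; -_; _-_; _⊖_)
  open import Data.Integer.DivMod using (n%ℕd<d)
  open import Data.Integer.Properties using (+-comm; pos-+; pos-*; neg-involutive; ⊖-≥; m-n≡m⊖n)
  open import Data.Integer.Tactic.RingSolver using (solve-∀)
  open import Data.Fin using (Fin; toℕ; fromℕ<; _↑ˡ_; _↑ʳ_)
  open import Data.Fin.Properties
    using (toℕ<n; toℕ-fromℕ<; toℕ-injective; splitAt-↑ˡ; splitAt-↑ʳ) renaming (_≟_ to _≟ᶠ_)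
  open import Data.Bool using (Bool; true; false) renaming (T to True)
  open import Data.Bool.Properties using (T-≡; T-∧; ⇔→≡)
  open import Data.Bool.ListAction using (any)
  open import Data.List using (allFin)
  open import Data.List.Relation.Unary.Any using (satisfied)
  open import Data.List.Relation.Unary.Any.Properties using (any⁺; any⁻)
  open import Data.List.Membership.Propositional using (lose)
  open import Data.List.Membership.Propositional.Properties using (∈-allFin)
  open import Data.Product using (_,_; proj₁; proj₂)
  open import Function using (_∘_; Equivalence; mk⇔)
  open import Relation.Nullary.Decidable using (⌊_⌋; toWitness; fromWitness)
  open import Relation.Binary.PropositionalEquality
  open RangeSums using (∑-cong; ∑-splitAt)
  open Congruences
  open Equivalence

  T-ext : ∀ {b b′} → (True b → True b′) → (True b′ → True b) → b ≡ b′
  T-ext f g = ⇔→≡ (mk⇔ (to T-≡ ∘ f ∘ from T-≡) (to T-≡ ∘ g ∘ from T-≡))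

  module WithDivisor (l v : ℕ) .{{_ : NonZero v}} .{{_ : NonZero (l ℕ.* v)}} where

    open Modulo v
    open Dihedral (l ℕ.* v)

    n : ℕ
    n = l ℕ.* v

    toFin : ℤ → Fin n
    toFin x = fromℕ< (n%ℕd<d x n)

    toℕ-toFin : ∀ x → + toℕ (toFin x) ≡ᵥ x
    toℕ-toFin x = ≡ᵥ-trans (≡⇒≡ᵥ (cong +_ (toℕ-fromℕ< _))) (remainder-≡ᵥ n (divides l refl) x)

    toℕ-⊕ : ∀ i j → + toℕ (i ⊕ j) ≡ᵥ + toℕ i + + toℕ j
    toℕ-⊕ i j = ≡ᵥ-trans (toℕ-toFin (+ (toℕ i ℕ.+ toℕ j))) (≡⇒≡ᵥ (pos-+ (toℕ i) (toℕ j)))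

    toℕ-⊖ : ∀ i → + toℕ (⊖ i) ≡ᵥ - + toℕ i
    toℕ-⊖ i = ≡ᵥ-trans (toℕ-toFin (+ (n ∸ toℕ i))) (by (+ l) (begin
      + (n ∸ toℕ i)             ≡⟨ sym (⊖-≥ (<⇒≤ (toℕ<n i))) ⟩
      n ⊖ toℕ i                 ≡⟨ sym (m-n≡m⊖n n (toℕ i)) ⟩
      + n - + toℕ i             ≡⟨ cong (λ s → s - + toℕ i) (pos-* l v) ⟩
      + l * + v - + toℕ i       ≡⟨ commute (+ l * + v) (+ toℕ i) ⟩
      - + toℕ i + + l * + v     ∎))
      where
        open ≡-Reasoning
        commute : ∀ m i → m - i ≡ - i + m
        commute = solve-∀

    toℕ-⊕⊖ : ∀ i j → + toℕ (i ⊕ (⊖ j)) ≡ᵥ + toℕ i - + toℕ j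
    toℕ-⊕⊖ i j = ≡ᵥ-trans (toℕ-⊕ i (⊖ j)) (+-cong-≡ᵥ (≡ᵥ-refl {+ toℕ i}) (toℕ-⊖ j))

    toℕ-⊕⊖⊖ : ∀ i j → + toℕ (i ⊕ (⊖ (⊖ j))) ≡ᵥ + toℕ i + + toℕ j
    toℕ-⊕⊖⊖ i j = ≡ᵥ-trans (toℕ-⊕⊖ i (⊖ j)) (+-cong-≡ᵥ (≡ᵥ-refl {+ toℕ i}) toℕ-⊖⊖)
      where toℕ-⊖⊖ : - + toℕ (⊖ j) ≡ᵥ + toℕ j
            toℕ-⊖⊖ = ≡ᵥ-trans (neg-cong-≡ᵥ (toℕ-⊖ j)) (≡⇒≡ᵥ (neg-involutive (+ toℕ j)))

    vertex-↑ˡ : ∀ i → vertex (i ↑ˡ n) ≡ (i , false)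
    vertex-↑ˡ i rewrite splitAt-↑ˡ n i n = refl

    vertex-↑ʳ : ∀ i → vertex (n ↑ʳ i) ≡ (i , true)
    vertex-↑ʳ i rewrite splitAt-↑ʳ n n i = refl

    ∑D : (Dih n → ℤ) → ℤ
    ∑D f = ∑ n (λ i → f (i , false)) + ∑ n (λ i → f (i , true))

    ∑D-cong : ∀ {f g : Dih n → ℤ} → (∀ h → f h ≡ g h) → ∑D f ≡ ∑D g
    ∑D-cong f≗g = cong₂ _+_ (∑-cong n (λ i → f≗g (i , false))) (∑-cong n (λ i → f≗g (i , true)))

    ∑D-swap : ∀ f → ∑D f ≡ ∑ n (λ i → f (i , true)) + ∑ n (λ i → f (i , false))
    ∑D-swap f = +-comm (∑ n (λ i → f (i , false))) (∑ n (λ i → f (i , true)))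

    ∑-vertex : ∀ f → ∑ (n ℕ.+ n) (f ∘ vertex) ≡ ∑D f
    ∑-vertex f = trans (∑-splitAt n n (f ∘ vertex))
                       (cong₂ _+_ (∑-cong n (cong f ∘ vertex-↑ˡ)) (∑-cong n (cong f ∘ vertex-↑ʳ)))

    inCoset : ℕ → Fin n → Bool
    inCoset b c = any (λ k → ⌊ c ≟ᶠ ((b ℕ.+ toℕ k ℕ.* v) mod n) ⌋) (allFin n)

    inCoset-sound : ∀ b c → True (inCoset b c) → toℕ c % v ≡ b % v
    inCoset-sound b c c∈ with satisfied (any⁻ _ (allFin n) c∈)
    ... | k , c≡ = begin
      toℕ c % v                             ≡⟨ cong (λ d → toℕ d % v) (toWitness c≡) ⟩
      toℕ ((b ℕ.+ toℕ k ℕ.* v) mod n) % v    ≡⟨ cong (_% v) (toℕ-fromℕ< _) ⟩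
      (b ℕ.+ toℕ k ℕ.* v) % n % v            ≡⟨ m∣n⇒o%n%m≡o%m v n _ (divides l refl) ⟩
      (b ℕ.+ toℕ k ℕ.* v) % v                ≡⟨ [m+kn]%n≡m%n b (toℕ k) v ⟩
      b % v                                 ∎
      where open ≡-Reasoning

    inCoset-complete : ∀ b c → toℕ c % v ≡ b → True (inCoset b c)
    inCoset-complete b c c%v≡b = any⁺ _ (lose (∈-allFin k) (fromWitness (toℕ-injective (begin
      toℕ c                                  ≡⟨ sym (m<n⇒m%n≡m (toℕ<n c)) ⟩
      toℕ c % n                              ≡⟨ cong (_% n) (m≡m%n+[m/n]*n (toℕ c) v) ⟩
      (toℕ c % v ℕ.+ toℕ c / v ℕ.* v) % n    ≡⟨ cong (λ r → (r ℕ.+ toℕ c / v ℕ.* v) % n) c%v≡b ⟩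
      (b ℕ.+ toℕ c / v ℕ.* v) % n            ≡⟨ cong (λ q → (b ℕ.+ q ℕ.* v) % n) (sym (toℕ-fromℕ< q<n)) ⟩
      (b ℕ.+ toℕ k ℕ.* v) % n                ≡⟨ sym (toℕ-fromℕ< _) ⟩
      toℕ ((b ℕ.+ toℕ k ℕ.* v) mod n)        ∎))))
      where
        open ≡-Reasoning
        q<n : toℕ c / v ℕ.< n
        q<n = ≤-<-trans (m/n≤m (toℕ c) v) (toℕ<n c)
        k : Fin n
        k = fromℕ< q<n

    inY-residue : ∀ (T : Fin v → Bool) c → inY v T c ≡ T (toℕ c mod v)
    inY-residue T c = T-ext sound complete
      where
        sound : True (inY v T c) → True (T (toℕ c mod v))
        sound c∈Y with satisfied (any⁻ _ (allFin v) c∈Y)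
        ... | b , b∈T∧c∈coset = subst (True ∘ T) b≡residue (proj₁ (to T-∧ b∈T∧c∈coset))
          where
            b≡residue : b ≡ toℕ c mod v
            b≡residue = toℕ-injective (begin
              toℕ b            ≡⟨ sym (m<n⇒m%n≡m (toℕ<n b)) ⟩
              toℕ b % v        ≡⟨ sym (inCoset-sound (toℕ b) c (proj₂ (to T-∧ b∈T∧c∈coset))) ⟩
              toℕ c % v        ≡⟨ sym (toℕ-fromℕ< _) ⟩
              toℕ (toℕ c mod v) ∎)
              where open ≡-Reasoning
        complete : True (T (toℕ c mod v)) → True (inY v T c)
        complete r∈T = any⁺ _ (lose (∈-allFin (toℕ c mod v))
                         (from T-∧ (r∈T , inCoset-complete _ c (sym (toℕ-fromℕ< _)))))

    inH-residue : ∀ c → inH v c ≡ (toℕ c % v ≡ᵇ 0)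
    inH-residue c = T-ext sound (inCoset-complete 0 c ∘ ≡ᵇ⇒≡ _ 0)
      where sound : True (inH v c) → True (toℕ c % v ≡ᵇ 0)
            sound c∈H = ≡⇒≡ᵇ _ 0 (trans (inCoset-sound 0 c c∈H) (m<n⇒m%n≡m (ℕ.>-nonZero⁻¹ v)))

module CayleyGraph where

  open import Defs
  open import Data.Nat as ℕ using (ℕ; suc; NonZero; _≡ᵇ_; s≤s)
  open import Data.Nat.Properties using (≡ᵇ⇒≡)
  open import Data.Nat.DivMod using (m<n⇒m%n≡m)
  open import Data.Integer using (ℤ; +_; _+_; _*_; -_; _-_; 0ℤ; 1ℤ; _%ℕ_)
  open import Data.Integer.Properties using (pos-+; pos-*)
  open import Data.Integer.Tactic.RingSolver using (solve-∀)
  open import Data.Fin using (Fin; toℕ)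
  open import Data.Fin.Properties using (toℕ-fromℕ<) renaming (_≟_ to _≟ᶠ_)
  open import Data.Bool using (Bool; true; false; _∧_; not) renaming (T to True)
  open import Data.Bool.Properties using (T-≡)
  open import Data.Product using (_,_)
  open import Function using (_∘_; Equivalence)
  open import Relation.Nullary.Decidable using (⌊_⌋)
  open import Relation.Binary.PropositionalEquality
  open PeriodicSums using (Periodic)
  open Congruences
  open DihedralFacts

  χℕ-χ : ∀ b → + χℕ b ≡ χ b
  χℕ-χ true  = refl
  χℕ-χ false = refl

  χ-∧-not : ∀ y h → (True h → True y) → χ (y ∧ not h) ≡ χ y - χ h
  χ-∧-not true  true  _   = refl
  χ-∧-not true  false _   = refl
  χ-∧-not false true  h⇒y with () ← h⇒y _
  χ-∧-not false false _   = refl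

  -- Ȳ + Ȳ⁽⁻¹⁾ = C̄ₙ + ⟨xᵛ⟩‾ in ℤ[Cₙ], compared coefficientwise.
  GroupRingCondition : (n v : ℕ) .{{_ : NonZero n}} → (Fin v → Bool) → Set
  GroupRingCondition n v T = ∀ c → χℕ (inY v T c) ℕ.+ χℕ (inY v T (⊖ c)) ≡ 1 ℕ.+ χℕ (inH v c)
    where open Dihedral n

  module Graph (a l : ℕ) .{{_ : NonZero (l ℕ.* suc (a ℕ.+ a))}}
      (T : Fin (suc (a ℕ.+ a)) → Bool) (T-origin : ∀ b → toℕ b ≡ 0 → T b ≡ true)
      (condition : GroupRingCondition (l ℕ.* suc (a ℕ.+ a)) (suc (a ℕ.+ a)) T)
      where

    v : ℕ
    v = suc (a ℕ.+ a)

    open Modulo v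
    open WithDivisor l v
    open Dihedral n

    Y H : ℤ → ℤ
    Y x = χ (T (residue x))
    H x = χ (x %ℕ v ≡ᵇ 0)

    Y-periodic : Periodic v Y
    Y-periodic x = cong (χ ∘ T) (residue-cong (+v-≡ᵥ x))

    H-periodic : Periodic v H
    H-periodic x = cong (λ r → χ (r ≡ᵇ 0)) (%ℕ-cong (+v-≡ᵥ x))

    H-origin : H 0ℤ ≡ 1ℤ
    H-origin = refl

    H-vanishes : ∀ j → j ℕ.< a ℕ.+ a → H (+ suc j) ≡ 0ℤ
    H-vanishes j j<2a = cong (λ r → χ (r ≡ᵇ 0)) (m<n⇒m%n≡m (s≤s j<2a))

    χ-inY : ∀ {c x} → + toℕ c ≡ᵥ x → χ (inY v T c) ≡ Y x
    χ-inY {c} c≡x = cong χ (trans (inY-residue T c) (cong T (residue-cong c≡x)))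

    χ-inH : ∀ {c x} → + toℕ c ≡ᵥ x → χ (inH v c) ≡ H x
    χ-inH {c} c≡x = cong χ (trans (inH-residue c) (cong (_≡ᵇ 0) (%ℕ-cong c≡x)))

    Y-pairing : ∀ x → Y x + Y (- x) ≡ 1ℤ + H x
    Y-pairing x = begin
      Y x + Y (- x)
        ≡⟨ sym (cong₂ _+_ (χ-inY (toℕ-toFin x))
                          (χ-inY (≡ᵥ-trans (toℕ-⊖ c) (neg-cong-≡ᵥ (toℕ-toFin x))))) ⟩
      χ (inY v T c) + χ (inY v T (⊖ c))
        ≡⟨ sym (cong₂ _+_ (χℕ-χ (inY v T c)) (χℕ-χ (inY v T (⊖ c)))) ⟩
      + χℕ (inY v T c) + + χℕ (inY v T (⊖ c))
        ≡⟨ sym (pos-+ (χℕ (inY v T c)) (χℕ (inY v T (⊖ c)))) ⟩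
      + (χℕ (inY v T c) ℕ.+ χℕ (inY v T (⊖ c)))
        ≡⟨ cong +_ (condition c) ⟩
      1ℤ + + χℕ (inH v c)
        ≡⟨ cong (λ s → 1ℤ + s) (trans (χℕ-χ (inH v c)) (χ-inH (toℕ-toFin x))) ⟩
      1ℤ + H x
        ∎
      where
        open ≡-Reasoning
        c : Fin n
        c = toFin x

    open CountingIdentities.Indicators a l Y H Y-periodic H-periodic H-origin H-vanishes Y-pairing
      hiding (v)

    χ-inX : ∀ {c x} → + toℕ c ≡ᵥ x → χ (inX v T c) ≡ X x
    χ-inX {c} c≡x = trans (χ-∧-not (inY v T c) (inH v c) inH⇒inY) (cong₂ _-_ (χ-inY c≡x) (χ-inH c≡x))
      where
        open Equivalence
        inH⇒inY : True (inH v c) → True (inY v T c)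
        inH⇒inY c∈H = from T-≡ (trans (inY-residue T c) (T-origin _ (trans (toℕ-fromℕ< _)
                        (≡ᵇ⇒≡ _ 0 (subst True (inH-residue c) c∈H)))))

    arcWeight : Dih n → Dih n → ℤ
    arcWeight g h = χ (connSet v T (h · inv g))

    -- For g = xᵖaˢ and h = x^q aᵗ, h g⁻¹ is x^(q−p) if s = t and x^(q+p) a otherwise.
    adj : Dih n → Dih n → ℤ
    adj (p , false) (q , false) = X (+ toℕ q - + toℕ p)
    adj (p , false) (q , true)  = Y (+ toℕ q + + toℕ p)
    adj (p , true)  (q , false) = Y (+ toℕ q + + toℕ p)
    adj (p , true)  (q , true)  = X (+ toℕ q - + toℕ p)

    arcWeight≡adj : ∀ g h → arcWeight g h ≡ adj g h
    arcWeight≡adj (p , false) (q , false) = χ-inX (toℕ-⊕⊖ q p)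
    arcWeight≡adj (p , false) (q , true)  = χ-inY (toℕ-⊕⊖⊖ q p)
    arcWeight≡adj (p , true)  (q , false) = χ-inY (toℕ-⊕ q p)
    arcWeight≡adj (p , true)  (q , true)  = χ-inX (toℕ-⊕⊖ q p)

    adj-rowSum : ∀ g → ∑D (adj g) ≡ + n
    adj-rowSum (p , false) = row-identity (+ toℕ p)
    adj-rowSum (p , true)  = trans (∑D-swap (adj (p , true))) (row-identity (+ toℕ p))

    adj-colSum : ∀ h → ∑D (λ g → adj g h) ≡ + n
    adj-colSum (q , false) = column-identity (+ toℕ q)
    adj-colSum (q , true)  = trans (∑D-swap (λ g → adj g (q , true))) (column-identity (+ toℕ q))

    adj-square : ∀ g h → ∑D (λ k → adj g k * adj k h) ≡ μ - + l * adj g h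
    adj-square (p , false) (q , false) = square-identity-X (+ toℕ p) (+ toℕ q)
    adj-square (p , false) (q , true)  = square-identity-Y (+ toℕ p) (+ toℕ q)
    adj-square (p , true)  (q , false) =
      trans (∑D-swap (λ k → adj (p , true) k * adj k (q , false))) (square-identity-Y (+ toℕ p) (+ toℕ q))
    adj-square (p , true)  (q , true)  =
      trans (∑D-swap (λ k → adj (p , true) k * adj k (q , true))) (square-identity-X (+ toℕ p) (+ toℕ q))

    dsrg-equation : ∀ I A → + (l ℕ.* suc a) * I + + (l ℕ.* a) * A + + (l ℕ.* suc a) * ((1ℤ - I) - A)
                            ≡ μ - + l * A
    dsrg-equation I A = trans (cong₂ (λ m k → m * I + k * A + m * ((1ℤ - I) - A)) (pos-* l (suc a)) (pos-* l a))
                              (collect (+ l) (+ a) I A)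
      where collect : ∀ l a I A → l * (1ℤ + a) * I + l * a * A + l * (1ℤ + a) * ((1ℤ - I) - A)
                                    ≡ l * (1ℤ + a) - l * A
            collect = solve-∀

    isDSRG : IsDSRG (n ℕ.+ n) n (l ℕ.* suc a) (l ℕ.* a) (l ℕ.* suc a) (graphArc v T)
    isDSRG = record { rowSum = rowSum ; colSum = colSum ; square = square }
      where
        open ≡-Reasoning
        A I : Fin (n ℕ.+ n) → Fin (n ℕ.+ n) → ℤ
        A u w = arcWeight (vertex u) (vertex w)
        I u w = χ ⌊ u ≟ᶠ w ⌋

        rowSum : ∀ u → ∑ (n ℕ.+ n) (A u) ≡ + n
        rowSum u = begin
          ∑ (n ℕ.+ n) (A u)              ≡⟨ ∑-vertex (arcWeight (vertex u)) ⟩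
          ∑D (arcWeight (vertex u))      ≡⟨ ∑D-cong (arcWeight≡adj (vertex u)) ⟩
          ∑D (adj (vertex u))            ≡⟨ adj-rowSum (vertex u) ⟩
          + n                            ∎

        colSum : ∀ w → ∑ (n ℕ.+ n) (λ u → A u w) ≡ + n
        colSum w = begin
          ∑ (n ℕ.+ n) (λ u → A u w)              ≡⟨ ∑-vertex (λ g → arcWeight g (vertex w)) ⟩
          ∑D (λ g → arcWeight g (vertex w))      ≡⟨ ∑D-cong (λ g → arcWeight≡adj g (vertex w)) ⟩
          ∑D (λ g → adj g (vertex w))            ≡⟨ adj-colSum (vertex w) ⟩
          + n                                    ∎

        square : ∀ u w → ∑ (n ℕ.+ n) (λ z → A u z * A z w)
                         ≡ + (l ℕ.* suc a) * I u w + + (l ℕ.* a) * A u w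
                             + + (l ℕ.* suc a) * ((1ℤ - I u w) - A u w)
        square u w = begin
          ∑ (n ℕ.+ n) (λ z → A u z * A z w)
            ≡⟨ ∑-vertex (λ k → arcWeight g k * arcWeight k h) ⟩
          ∑D (λ k → arcWeight g k * arcWeight k h)
            ≡⟨ ∑D-cong (λ k → cong₂ _*_ (arcWeight≡adj g k) (arcWeight≡adj k h)) ⟩
          ∑D (λ k → adj g k * adj k h)
            ≡⟨ adj-square g h ⟩
          μ - + l * adj g h
            ≡⟨ cong (λ s → μ - + l * s) (sym (arcWeight≡adj g h)) ⟩
          μ - + l * A u w
            ≡⟨ sym (dsrg-equation (I u w) (A u w)) ⟩
          + (l ℕ.* suc a) * I u w + + (l ℕ.* a) * A u w
            + + (l ℕ.* suc a) * ((1ℤ - I u w) - A u w)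
            ∎
          where
            g h : Dih n
            g = vertex u
            h = vertex w

open import Defs
open import Data.Nat using (ℕ; NonZero; suc; _+_; _*_; _∸_; _/_; _%_)
open import Data.Nat.Properties using (*-suc; m+n∸m≡n)
open import Data.Nat.Divisibility using (_∣_; divides)
open import Data.Nat.DivMod using (m≡m%n+[m/n]*n; m*n/n≡m)
open import Data.Nat.Tactic.RingSolver using (solve-∀)
open import Data.Fin using (Fin; toℕ)
open import Data.Bool using (Bool; true)
open import Data.Product using (∃-syntax; _,_)
open import Relation.Binary.PropositionalEquality

odd⇒≡2a+1 : ∀ v → v % 2 ≡ 1 → ∃[ a ] v ≡ suc (a + a)
odd⇒≡2a+1 v v%2≡1 = v / 2 , (begin
  v                  ≡⟨ m≡m%n+[m/n]*n v 2 ⟩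
  v % 2 + v / 2 * 2  ≡⟨ cong (λ r → r + v / 2 * 2) v%2≡1 ⟩
  1 + v / 2 * 2      ≡⟨ double (v / 2) ⟩
  suc (v / 2 + v / 2) ∎)
  where
    open ≡-Reasoning
    double : ∀ a → 1 + a * 2 ≡ suc (a + a)
    double = solve-∀

μ-parameter : ∀ l a → let v = suc (a + a) in (l * v + l * v / v) / 2 ≡ l * suc a
μ-parameter l a = begin
  (l * v + l * v / v) / 2  ≡⟨ cong (λ q → (l * v + q) / 2) (m*n/n≡m l v) ⟩
  (l * v + l) / 2          ≡⟨ cong (_/ 2) (twice l a) ⟩
  l * suc a * 2 / 2        ≡⟨ m*n/n≡m (l * suc a) 2 ⟩
  l * suc a                ∎
  where
    open ≡-Reasoning
    v : ℕ
    v = suc (a + a)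
    twice : ∀ l a → l * suc (a + a) + l ≡ l * suc a * 2
    twice = solve-∀

λ-parameter : ∀ l a → let v = suc (a + a) in (l * v ∸ l * v / v) / 2 ≡ l * a
λ-parameter l a = begin
  (l * v ∸ l * v / v) / 2     ≡⟨ cong (λ q → (l * v ∸ q) / 2) (m*n/n≡m l v) ⟩
  (l * v ∸ l) / 2             ≡⟨ cong (λ m → (m ∸ l) / 2) (*-suc l (a + a)) ⟩
  (l + l * (a + a) ∸ l) / 2   ≡⟨ cong (_/ 2) (m+n∸m≡n l (l * (a + a))) ⟩
  l * (a + a) / 2             ≡⟨ cong (_/ 2) (twice l a) ⟩
  l * a * 2 / 2               ≡⟨ m*n/n≡m (l * a) 2 ⟩
  l * a                       ∎
  where
    open ≡-Reasoning
    v : ℕ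
    v = suc (a + a)
    twice : ∀ l a → l * (a + a) ≡ l * a * 2
    twice = solve-∀

IsDSRG-cong : ∀ {N k μ μ′ λ′ λ″ arc} → μ ≡ μ′ → λ′ ≡ λ″ →
              IsDSRG N k μ λ′ μ arc → IsDSRG N k μ′ λ″ μ′ arc
IsDSRG-cong refl refl G = G

mainTheorem13 : (n : ℕ) .{{_ : NonZero n}} (v : ℕ) .{{_ : NonZero v}} →
    v ∣ n → v % 2 ≡ 1 →
    (T : Fin v → Bool) → (∀ (b : Fin v) → toℕ b ≡ 0 → T b ≡ true) →
    (∀ (c : Fin n) → χℕ (Dihedral.inY n v T c) + χℕ (Dihedral.inY n v T (Dihedral.⊖_ n c))
                       ≡ 1 + χℕ (Dihedral.inH n v c)) →
    IsDSRG (n + n) n ((n + n / v) / 2) ((n ∸ n / v) / 2) ((n + n / v) / 2)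
           (Dihedral.graphArc n v T)
mainTheorem13 .(l * v) v (divides l refl) v-odd T T-origin condition with odd⇒≡2a+1 v v-odd
... | a , refl = IsDSRG-cong (sym (μ-parameter l a)) (sym (λ-parameter l a))
                             (CayleyGraph.Graph.isDSRG a l T T-origin condition)
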